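{- (1) A positive integer $n$ is a leader if and only if it is the smallest positive integer having defect equal to $\delta(n)$. (2) For every positive integer $m$ there is a unique leader $n\le m$ such that $\delta(n)=\delta(m)$; for it, $m=n\cdot 3^k$ for some integer $k\ge 0$.
   Context: For a positive integer $n$, its complexity $\|n\|$ is the least number of $1$'s needed to write $n$ using only the constant $1$, addition, multiplication, and parentheses (so $\|1\|=1$ and for $n>1$, $\|n\|=\min\{\|a\|+\|b\|: a,b<n,\ a+b=n \text{ or } ab=n\}$). The defect of $n$ is $\delta(n)=\|n\|-3\log_3 n$. A positive integer $n$ is called a leader if it is not the case that $3\mid n$ and $\|n\|=3+\|n/3\|$ (i.e., either $3\nmid n$, or $3\mid n$ and $\|n\|<3+\|n/3\|$). -}

module Defs where

open import Data.Nat using (ℕ; zero; suc; _+_; _*_; _∸_; _^_; _≤_; _⊓_; _≡ᵇ_)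
open import Data.Nat.DivMod using (_/_)
open import Data.Nat.Divisibility using (_∣_; _∣?_)
open import Data.List using (List; []; _∷_; _++_; applyUpTo; concat)
open import Data.Bool using (if_then_else_)
open import Data.Product using (_×_)
open import Relation.Nullary using (¬_; yes; no)
open import Relation.Binary.PropositionalEquality using (_≡_)

minList : ℕ → List ℕ → ℕ
minList d []       = d
minList d (x ∷ xs) = x ⊓ minList x xs

-- Candidate values ‖a‖+‖b‖ for n, given f = complexity on 1..n-1:
--   a + b = n  with a,b < n  (a = 1 .. n-1, b = n - a)
--   a * b = n  with a,b < n  (a = 2 .. n-1, a ∣ n, b = n / a)
addCands : (ℕ → ℕ) → ℕ → List ℕ
addCands f n = applyUpTo (λ j → f (suc j) + f (n ∸ suc j)) (n ∸ 1)

mulCands : (ℕ → ℕ) → ℕ → List ℕ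
mulCands f n = concat (applyUpTo cand (n ∸ 2))
  where
  cand : ℕ → List ℕ
  cand j with suc (suc j) ∣? n
  ... | yes _ = f (suc (suc j)) + f (n / suc (suc j)) ∷ []
  ... | no  _ = []

step : (ℕ → ℕ) → ℕ → ℕ
step f zero          = 0
step f (suc zero)    = 1
step f n@(suc (suc _)) with addCands f n ++ mulCands f n
... | []     = 0   -- unreachable: addCands is nonempty for n ≥ 2
... | c ∷ cs = minList c (c ∷ cs)

-- table k i = ‖i‖ for 1 ≤ i ≤ k
table : ℕ → ℕ → ℕ
table zero    = λ _ → 0
table (suc k) = λ i → if i ≡ᵇ suc k then step (table k) (suc k) else table k i

-- integer complexity ‖n‖ (meaningful for n ≥ 1; ‖0‖ = 0 is a junk value)
‖_‖ : ℕ → ℕ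
‖ n ‖ = table n n

-- δ(n) = δ(m), i.e. ‖n‖ - 3 log₃ n = ‖m‖ - 3 log₃ m, stated exactly
-- in ℕ as 3^‖n‖ · m³ = 3^‖m‖ · n³.
SameDefect : ℕ → ℕ → Set
SameDefect n m = 3 ^ ‖ n ‖ * m ^ 3 ≡ 3 ^ ‖ m ‖ * n ^ 3

Leader : ℕ → Set
Leader n = ¬ (3 ∣ n × ‖ n ‖ ≡ 3 + ‖ n / 3 ‖)

{-# OPTIONS --safe #-}
-- Write n = x · 3^b and m = y · 3^a with 3 ∤ x, y. The defect equation 3^‖m‖ n³ = 3^‖n‖ m³
-- then reads x³ · 3^(‖m‖+3b) = y³ · 3^(‖n‖+3a), and uniqueness of the 3-free part gives x = y
-- and ‖n‖ − 3b = ‖m‖ − 3a: numbers of equal defect differ by a power of 3 each factor of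
-- which costs exactly three 1's. As ‖3w‖ ≤ ‖w‖ + 3 always, a number n = 3^(k+1)·m of that form
-- has ‖n‖ = 3 + ‖n/3‖ and is no leader; conversely n/3 has the same defect as a non-leader n.
-- Dividing by 3 while the number is not a leader therefore reaches the least, and only,
-- leader of the defect class.
module Submission where

open import Defs
open import Data.Bool using (true; false; T)
open import Data.List using (_∷_)
open import Data.List.Membership.Propositional using (_∈_)
open import Data.List.Membership.Propositional.Properties using (∈-++⁺ʳ)
open import Data.List.Relation.Unary.Any using (here; there)
open import Data.Nat
open import Data.Nat.DivMod using (_/_; _%_; m*n/n≡m; m/n*n≡m)
open import Data.Nat.Divisibility using (_∣_; _∣?_; divides; divides-refl; n∣m⇒m%n≡0; ∣1⇒≡1)
open import Data.Nat.Induction using (<-rec)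
open import Data.Nat.Primality using (Prime; prime?; prime⇒nonTrivial; euclidsLemma)
open import Data.Nat.Properties
open import Algebra.Properties.CommutativeSemigroup *-commutativeSemigroup using (x∙yz≈y∙xz)
open import Data.Nat.Tactic.RingSolver using (solve-∀)
open import Data.Product using (_×_; _,_; ∃₂; ∃-syntax)
open import Data.Sum using (_⊎_; inj₁; inj₂)
open import Function.Bundles using (_⇔_; mk⇔)
open import Relation.Binary.Definitions using (tri<; tri≈; tri>)
open import Relation.Binary.PropositionalEquality
open import Relation.Nullary using (¬_; Dec; yes; no; contradiction)
open import Relation.Nullary.Decidable using (T?; _×-dec_; from-yes)

m*n^[1+k]≡m*n^k*n : ∀ m n k → m * n ^ suc k ≡ m * n ^ k * n
m*n^[1+k]≡m*n^k*n m n k = trans (cong (m *_) (*-comm n (n ^ k))) (sym (*-assoc m (n ^ k) n))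

^-distribʳ-* : ∀ m n k → (m * n) ^ k ≡ m ^ k * n ^ k
^-distribʳ-* m n zero    = refl
^-distribʳ-* m n (suc k) =
  trans (cong (m * n *_) (^-distribʳ-* m n k)) ([m*n]*[o*p]≡[m*o]*[n*p] m n (m ^ k) (n ^ k))

^-cancelʳ-≡ : ∀ k .{{_ : NonZero k}} {m n} → m ^ k ≡ n ^ k → m ≡ n
^-cancelʳ-≡ k {m} {n} eq with <-cmp m n
... | tri< m<n _ _ = contradiction eq (<⇒≢ (^-monoˡ-< k m<n))
... | tri≈ _ m≡n _ = m≡n
... | tri> _ _ n<m = contradiction (sym eq) (<⇒≢ (^-monoˡ-< k n<m))

p^c*[x*p^b]^k≡x^k*p^[c+b*k] : ∀ p c x b k → p ^ c * (x * p ^ b) ^ k ≡ x ^ k * p ^ (c + b * k)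
p^c*[x*p^b]^k≡x^k*p^[c+b*k] p c x b k = begin
  p ^ c * (x * p ^ b) ^ k         ≡⟨ cong (p ^ c *_) (^-distribʳ-* x (p ^ b) k) ⟩
  p ^ c * (x ^ k * (p ^ b) ^ k)   ≡⟨ cong (λ y → p ^ c * (x ^ k * y)) (^-*-assoc p b k) ⟩
  p ^ c * (x ^ k * p ^ (b * k))   ≡⟨ x∙yz≈y∙xz (p ^ c) (x ^ k) (p ^ (b * k)) ⟩
  x ^ k * (p ^ c * p ^ (b * k))   ≡⟨ cong (x ^ k *_) (^-distribˡ-+-* p c (b * k)) ⟨
  x ^ k * p ^ (c + b * k)         ∎
  where open ≡-Reasoning

prime∤⇒∤^ : ∀ {p m} → Prime p → ¬ p ∣ m → ∀ k → ¬ p ∣ m ^ k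
prime∤⇒∤^ pp p∤m zero    p∣1 = nonTrivial⇒≢1 {{prime⇒nonTrivial pp}} (∣1⇒≡1 p∣1)
prime∤⇒∤^ {m = m} pp p∤m (suc k) p∣m^[1+k] with euclidsLemma m (m ^ k) pp p∣m^[1+k]
... | inj₁ p∣m   = p∤m p∣m
... | inj₂ p∣m^k = prime∤⇒∤^ pp p∤m k p∣m^k

p-free-part : ∀ {p} → 1 < p → ∀ n → 1 ≤ n → ∃₂ λ x a → ¬ p ∣ x × n ≡ x * p ^ a
p-free-part {p} 1<p = <-rec _ go
  where
  go : ∀ n → (∀ {m} → m < n → 1 ≤ m → ∃₂ λ x a → ¬ p ∣ x × m ≡ x * p ^ a) →
       1 ≤ n → ∃₂ λ x a → ¬ p ∣ x × n ≡ x * p ^ a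
  go n rec 1≤n with p ∣? n
  ... | no p∤n = n , 0 , p∤n , sym (*-identityʳ n)
  go .(zero * p) rec () | yes (divides-refl zero)
  go .(suc q * p) rec 1≤n | yes (divides-refl (suc q))
    with x , a , p∤x , q≡ ← rec (m<m*n (suc q) p 1<p) (s≤s z≤n)
    = x , suc a , p∤x , trans (cong (_* p) q≡) (sym (m*n^[1+k]≡m*n^k*n x p a))

p-free-part-unique : ∀ {p} .{{_ : NonZero p}} {x y} a b → ¬ p ∣ x → ¬ p ∣ y →
                x * p ^ a ≡ y * p ^ b → a ≡ b × x ≡ y
p-free-part-unique {p} {x} {y} zero zero p∤x p∤y eq =
  refl , trans (sym (*-identityʳ x)) (trans eq (*-identityʳ y))
p-free-part-unique {p} {x} {y} (suc a) zero p∤x p∤y eq =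
  contradiction (divides (x * p ^ a)
    (trans (sym (*-identityʳ y)) (trans (sym eq) (m*n^[1+k]≡m*n^k*n x p a)))) p∤y
p-free-part-unique {p} {x} {y} zero (suc b) p∤x p∤y eq =
  contradiction (divides (y * p ^ b)
    (trans (sym (*-identityʳ x)) (trans eq (m*n^[1+k]≡m*n^k*n y p b)))) p∤x
p-free-part-unique {p} {x} {y} (suc a) (suc b) p∤x p∤y eq
  with a≡b , x≡y ← p-free-part-unique a b p∤x p∤y (*-cancelʳ-≡ _ _ p
         (trans (sym (m*n^[1+k]≡m*n^k*n x p a)) (trans eq (m*n^[1+k]≡m*n^k*n y p b))))
  = cong suc a≡b , x≡y

minList-≤ : ∀ d {xs y} → y ∈ xs → minList d xs ≤ y
minList-≤ d {x ∷ _}  (here refl) = m⊓n≤m x _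
minList-≤ d {x ∷ xs} (there y∈xs) = ≤-trans (m⊓n≤n x _) (minList-≤ x y∈xs)

‖suc‖≡step : ∀ k → ‖ suc k ‖ ≡ step (table k) (suc k)
‖suc‖≡step k with k ≡ᵇ k | ≡⇒≡ᵇ k k refl
... | true | _ = refl

table-≢ : ∀ k {i} → i ≢ suc k → table (suc k) i ≡ table k i
table-≢ k {i} i≢ with i ≡ᵇ suc k in eq
... | true  = contradiction (≡ᵇ⇒≡ i (suc k) (subst T (sym eq) _)) i≢
... | false = refl

table-≤ : ∀ k {i} → i ≤ k → table k i ≡ ‖ i ‖
table-≤ zero    z≤n = refl
table-≤ (suc k) i≤1+k with m≤n⇒m<n∨m≡n i≤1+k
... | inj₁ i<1+k = trans (table-≢ k (<⇒≢ i<1+k)) (table-≤ k (≤-pred i<1+k))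
... | inj₂ refl  = refl

3-factor∈mulCands : ∀ f k → 3 ∣ 4 + k → f 3 + f ((4 + k) / 3) ∈ mulCands f (4 + k)
-- 3 ∣? 4 + k evaluates to this test; abstracting it lets the a = 3 entry of mulCands reduce.
3-factor∈mulCands f k 3∣n with T? ((4 + k) % 3 ≡ᵇ 0)
... | yes _   = ∈-++⁺ʳ _ (here refl)
... | no  3∤n = contradiction (≡⇒≡ᵇ _ 0 (n∣m⇒m%n≡0 _ 3 3∣n)) 3∤n

step≤mulCand : ∀ f k {y} → y ∈ mulCands f (2 + k) → step f (2 + k) ≤ y
step≤mulCand f k y∈ = minList-≤ (f 1 + f (suc k)) (∈-++⁺ʳ (addCands f (2 + k)) y∈)

‖*3‖≤ : ∀ q → ‖ q * 3 ‖ ≤ ‖ q ‖ + 3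
‖*3‖≤ zero          = z≤n
‖*3‖≤ (suc zero)    = n≤1+n 3
‖*3‖≤ q@(suc (suc r)) = begin
  ‖ q * 3 ‖             ≡⟨ ‖suc‖≡step (5 + r * 3) ⟩
  step f (q * 3)        ≤⟨ step≤mulCand f (4 + r * 3) (3-factor∈mulCands f (2 + r * 3) (divides-refl q)) ⟩
  f 3 + f (q * 3 / 3)   ≡⟨ cong₂ _+_ (table-≤ (5 + r * 3) (s≤s (s≤s (s≤s z≤n))))
                                     (trans (cong f (m*n/n≡m q 3)) (table-≤ (5 + r * 3) q≤)) ⟩
  3 + ‖ q ‖             ≡⟨ +-comm 3 ‖ q ‖ ⟩
  ‖ q ‖ + 3             ∎
  where
  open ≤-Reasoning
  f : ℕ → ℕ
  f = table (5 + r * 3)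
  q≤ : q ≤ 5 + r * 3
  q≤ = s≤s (s≤s (≤-trans (m≤m*n r 3) (m≤n+m (r * 3) 3)))

‖*3^‖≤ : ∀ n k → ‖ n * 3 ^ k ‖ ≤ ‖ n ‖ + k * 3
‖*3^‖≤ n zero    = ≤-reflexive (trans (cong ‖_‖ (*-identityʳ n)) (sym (+-identityʳ ‖ n ‖)))
‖*3^‖≤ n (suc k) = begin
  ‖ n * 3 ^ suc k ‖     ≡⟨ cong ‖_‖ (m*n^[1+k]≡m*n^k*n n 3 k) ⟩
  ‖ n * 3 ^ k * 3 ‖     ≤⟨ ‖*3‖≤ (n * 3 ^ k) ⟩
  ‖ n * 3 ^ k ‖ + 3     ≤⟨ +-monoˡ-≤ 3 (‖*3^‖≤ n k) ⟩
  ‖ n ‖ + k * 3 + 3     ≡⟨ +-assoc ‖ n ‖ (k * 3) 3 ⟩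
  ‖ n ‖ + (k * 3 + 3)   ≡⟨ cong (‖ n ‖ +_) (+-comm (k * 3) 3) ⟩
  ‖ n ‖ + suc k * 3     ∎
  where open ≤-Reasoning

record Scaled (k n m : ℕ) : Set where
  constructor scaled
  field
    value      : m ≡ n * 3 ^ k
    complexity : ‖ m ‖ ≡ ‖ n ‖ + k * 3

Scaled-refl : ∀ n → Scaled 0 n n
Scaled-refl n = scaled (sym (*-identityʳ n)) (sym (+-identityʳ ‖ n ‖))

Scaled-trans : ∀ {j k a b c} → Scaled j a b → Scaled k b c → Scaled (j + k) a c
Scaled-trans {j} {k} {a} (scaled refl ‖b‖≡) (scaled refl ‖c‖≡) = scaled
  (trans (*-assoc a (3 ^ j) (3 ^ k)) (cong (a *_) (sym (^-distribˡ-+-* 3 j k))))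
  (trans ‖c‖≡ (trans (cong (_+ k * 3) ‖b‖≡) (trans (+-assoc ‖ a ‖ (j * 3) (k * 3))
    (cong (‖ a ‖ +_) (sym (*-distribʳ-+ 3 j k))))))

Scaled-≤ : ∀ {k n m} → Scaled k n m → n ≤ m
Scaled-≤ {k} {n} (scaled refl _) = m≤m*n n (3 ^ k) {{m^n≢0 3 k}}

Scaled-1≤ : ∀ {k n m} → 1 ≤ m → Scaled k n m → 1 ≤ n
Scaled-1≤ {n = suc _} _ _ = s≤s z≤n
Scaled-1≤ {n = zero} 1≤m (scaled refl _) = 1≤m

Scaled-< : ∀ {k n m} → 1 ≤ m → Scaled (suc k) n m → n < m
Scaled-< {n = zero} () (scaled refl _)
Scaled-< {k} {n@(suc _)} _ (scaled refl _) =
  m<m*n n (3 ^ suc k) (≤-trans (s≤s (s≤s z≤n)) (*-monoʳ-≤ 3 (m^n>0 3 k)))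

Scaled⇒SameDefect : ∀ {k n m} → Scaled k n m → SameDefect n m
Scaled⇒SameDefect {k} {n} (scaled refl ‖m‖≡) = begin
  3 ^ ‖ n ‖ * (n * 3 ^ k) ^ 3       ≡⟨ p^c*[x*p^b]^k≡x^k*p^[c+b*k] 3 ‖ n ‖ n k 3 ⟩
  n ^ 3 * 3 ^ (‖ n ‖ + k * 3)       ≡⟨ cong (λ c → n ^ 3 * 3 ^ c) ‖m‖≡ ⟨
  n ^ 3 * 3 ^ ‖ n * 3 ^ k ‖         ≡⟨ *-comm (n ^ 3) _ ⟩
  3 ^ ‖ n * 3 ^ k ‖ * n ^ 3         ∎
  where open ≡-Reasoning

SameDefect-trans : ∀ {a b c} → SameDefect a b → SameDefect b c → SameDefect a c
SameDefect-trans {a} {b} {c} ab bc = *-cancelˡ-≡ _ _ (3 ^ ‖ b ‖) {{m^n≢0 3 ‖ b ‖}} (begin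
  B * (A * c ^ 3)   ≡⟨ x∙yz≈y∙xz B A (c ^ 3) ⟩
  A * (B * c ^ 3)   ≡⟨ cong (A *_) bc ⟩
  A * (C * b ^ 3)   ≡⟨ x∙yz≈y∙xz A C (b ^ 3) ⟩
  C * (A * b ^ 3)   ≡⟨ cong (C *_) ab ⟩
  C * (B * a ^ 3)   ≡⟨ x∙yz≈y∙xz C B (a ^ 3) ⟩
  B * (C * a ^ 3)   ∎)
  where
  open ≡-Reasoning
  A = 3 ^ ‖ a ‖
  B = 3 ^ ‖ b ‖
  C = 3 ^ ‖ c ‖

Scaled-from-3-free-parts : ∀ {m n x} a j → m ≡ x * 3 ^ a → n ≡ x * 3 ^ (a + j) →
                 ‖ m ‖ + (a + j) * 3 ≡ ‖ n ‖ + a * 3 → Scaled j m n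
Scaled-from-3-free-parts {x = x} a j refl refl ‖‖≡ = scaled
  (trans (cong (x *_) (^-distribˡ-+-* 3 a j)) (sym (*-assoc x (3 ^ a) (3 ^ j))))
  (sym (+-cancelʳ-≡ (a * 3) _ _ (trans (regroup ‖ x * 3 ^ a ‖ a j) ‖‖≡)))
  where
  regroup : ∀ u a j → u + j * 3 + a * 3 ≡ u + (a + j) * 3
  regroup = solve-∀

3-prime : Prime 3
3-prime = from-yes (prime? 3)

SameDefect-in-3-free-parts : ∀ {m n x y a b} → m ≡ y * 3 ^ a → n ≡ x * 3 ^ b → SameDefect m n →
                             x ^ 3 * 3 ^ (‖ m ‖ + b * 3) ≡ y ^ 3 * 3 ^ (‖ n ‖ + a * 3)
SameDefect-in-3-free-parts {m} {n} {x} {y} {a} {b} refl refl sd = begin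
  x ^ 3 * 3 ^ (‖ m ‖ + b * 3)   ≡⟨ p^c*[x*p^b]^k≡x^k*p^[c+b*k] 3 ‖ m ‖ x b 3 ⟨
  3 ^ ‖ m ‖ * n ^ 3             ≡⟨ sd ⟩
  3 ^ ‖ n ‖ * m ^ 3             ≡⟨ p^c*[x*p^b]^k≡x^k*p^[c+b*k] 3 ‖ n ‖ y a 3 ⟩
  y ^ 3 * 3 ^ (‖ n ‖ + a * 3)   ∎
  where open ≡-Reasoning

SameDefect⇒Scaled : ∀ {m n} → 1 ≤ m → 1 ≤ n → SameDefect m n →
                    ∃[ k ] (Scaled k m n ⊎ Scaled k n m)
SameDefect⇒Scaled {m} {n} 1≤m 1≤n sd
  with y , a , 3∤y , m≡ ← p-free-part (s≤s (s≤s z≤n)) m 1≤m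
     | x , b , 3∤x , n≡ ← p-free-part (s≤s (s≤s z≤n)) n 1≤n
  with ‖‖≡ , x³≡y³ ← p-free-part-unique {x = x ^ 3} {y ^ 3} (‖ m ‖ + b * 3) (‖ n ‖ + a * 3)
                       (prime∤⇒∤^ 3-prime 3∤x 3) (prime∤⇒∤^ 3-prime 3∤y 3)
                       (SameDefect-in-3-free-parts {x = x} {y} {a} {b} m≡ n≡ sd)
  with refl ← ^-cancelʳ-≡ 3 {x} {y} x³≡y³
  with ≤-total a b
... | inj₁ a≤b with j , refl ← m≤n⇒∃[o]m+o≡n a≤b = j , inj₁ (Scaled-from-3-free-parts {x = y} a j m≡ n≡ ‖‖≡)
... | inj₂ b≤a with j , refl ← m≤n⇒∃[o]m+o≡n b≤a = j , inj₂ (Scaled-from-3-free-parts {x = y} b j n≡ m≡ (sym ‖‖≡))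

NonLeader : ℕ → Set
NonLeader n = 3 ∣ n × ‖ n ‖ ≡ 3 + ‖ n / 3 ‖

nonLeader? : ∀ n → Dec (NonLeader n)
nonLeader? n = 3 ∣? n ×-dec ‖ n ‖ ≟ 3 + ‖ n / 3 ‖

NonLeader⇒Scaled : ∀ {n} → NonLeader n → Scaled 1 (n / 3) n
NonLeader⇒Scaled (3∣n , ‖n‖≡) = scaled (sym (m/n*n≡m 3∣n)) (trans ‖n‖≡ (+-comm 3 _))

Scaled-suc⇒NonLeader : ∀ {k m n} → Scaled (suc k) m n → NonLeader n
Scaled-suc⇒NonLeader {k} {m} (scaled refl ‖n‖≡) =
  subst NonLeader (sym (m*n^[1+k]≡m*n^k*n m 3 k))
    (divides-refl w , trans (≤-antisym upper lower) (cong (λ v → 3 + ‖ v ‖) (sym (m*n/n≡m w 3))))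
  where
  open ≤-Reasoning
  w = m * 3 ^ k
  upper : ‖ w * 3 ‖ ≤ 3 + ‖ w ‖
  upper = ≤-trans (‖*3‖≤ w) (≤-reflexive (+-comm ‖ w ‖ 3))
  lower : 3 + ‖ w ‖ ≤ ‖ w * 3 ‖
  lower = begin
    3 + ‖ w ‖             ≤⟨ +-monoʳ-≤ 3 (‖*3^‖≤ m k) ⟩
    3 + (‖ m ‖ + k * 3)   ≡⟨ +-assoc 3 ‖ m ‖ (k * 3) ⟨
    3 + ‖ m ‖ + k * 3     ≡⟨ cong (_+ k * 3) (+-comm 3 ‖ m ‖) ⟩
    ‖ m ‖ + 3 + k * 3     ≡⟨ +-assoc ‖ m ‖ 3 (k * 3) ⟩
    ‖ m ‖ + suc k * 3     ≡⟨ trans (cong ‖_‖ (sym (m*n^[1+k]≡m*n^k*n m 3 k))) ‖n‖≡ ⟨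
    ‖ w * 3 ‖             ∎

Leader⇒minimal : ∀ {n} → 1 ≤ n → Leader n → ∀ m → 1 ≤ m → SameDefect m n → n ≤ m
Leader⇒minimal 1≤n leader m 1≤m sd with SameDefect⇒Scaled 1≤m 1≤n sd
... | _     , inj₂ n↝m              = Scaled-≤ n↝m
... | zero  , inj₁ (scaled n≡m*1 _) = ≤-reflexive (trans n≡m*1 (*-identityʳ m))
... | suc _ , inj₁ m↝n              = contradiction (Scaled-suc⇒NonLeader m↝n) leader

minimal⇒Leader : ∀ {n} → 1 ≤ n → (∀ m → 1 ≤ m → SameDefect m n → n ≤ m) → Leader n
minimal⇒Leader {n} 1≤n minimal nonLeader =
  <⇒≱ (Scaled-< 1≤n n/3↝n) (minimal (n / 3) (Scaled-1≤ 1≤n n/3↝n) (Scaled⇒SameDefect n/3↝n))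
  where
  n/3↝n : Scaled 1 (n / 3) n
  n/3↝n = NonLeader⇒Scaled nonLeader

Leader-below : ∀ m → 1 ≤ m → ∃₂ λ k n → Leader n × Scaled k n m
Leader-below = <-rec _ go
  where
  go : ∀ m → (∀ {m′} → m′ < m → 1 ≤ m′ → ∃₂ λ k n → Leader n × Scaled k n m′) →
       1 ≤ m → ∃₂ λ k n → Leader n × Scaled k n m
  go m rec 1≤m with nonLeader? m
  ... | no leader = 0 , m , leader , Scaled-refl m
  ... | yes nonLeader
    with m/3↝m ← NonLeader⇒Scaled nonLeader
    with k , n , leader , n↝m/3 ← rec (Scaled-< 1≤m m/3↝m) (Scaled-1≤ 1≤m m/3↝m)
    = k + 1 , n , leader , Scaled-trans n↝m/3 m/3↝m

Leader-unique : ∀ {n n′} → 1 ≤ n → 1 ≤ n′ → Leader n → Leader n′ → SameDefect n n′ → n ≡ n′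
Leader-unique 1≤n 1≤n′ leader leader′ sd =
  ≤-antisym (Leader⇒minimal 1≤n leader _ 1≤n′ (sym sd)) (Leader⇒minimal 1≤n′ leader′ _ 1≤n sd)

proposition2p8 :
  ((n : ℕ) → 1 ≤ n →
    (Leader n ⇔ ((m : ℕ) → 1 ≤ m → SameDefect m n → n ≤ m)))
  ×
  ((m : ℕ) → 1 ≤ m →
    ∃[ n ] (1 ≤ n × n ≤ m × Leader n × SameDefect n m
      × ((n′ : ℕ) → 1 ≤ n′ → n′ ≤ m → Leader n′ → SameDefect n′ m → n′ ≡ n)
      × ∃[ k ] (m ≡ n * 3 ^ k)))
proposition2p8 =
  (λ n 1≤n → mk⇔ (Leader⇒minimal 1≤n) (minimal⇒Leader 1≤n)) ,
  λ m 1≤m →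
    let k , n , leader , n↝m = Leader-below m 1≤m
        1≤n = Scaled-1≤ 1≤m n↝m
        sd  = Scaled⇒SameDefect n↝m
    in  n , 1≤n , Scaled-≤ n↝m , leader , sd ,
        (λ n′ 1≤n′ _ leader′ sd′ →
           Leader-unique 1≤n′ 1≤n leader′ leader (SameDefect-trans {n′} {m} {n} sd′ (sym sd))) ,
        k , Scaled.value n↝m
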